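{- Let $\mathcal A$ be a finite alphabet with $r$ letters and a pair of strict total orders $(<_A,<_D)$, and let $L$ be a language on $\mathcal A$ satisfying the order condition for $(<_A,<_D)$. Let $w\in L$, let $U_1,\dots,U_s$ ($1\le s\le r$) be distinct suffix (resp. prefix) return words of $w$ in $L$, let $\mathcal A'=\{a_1,\dots,a_s\}$, $\phi$ the morphism with $\phi a_i=U_i$, and $(<_{Aw},<_{Dw})$ the derived orders with respect to $w$. Then for every word $v$ on $\mathcal A'$, $F(w\phi v)$ (resp. $F(\phi v\, w)$) satisfies the order condition for $(<_A,<_D)$ if and only if $F(v)$ satisfies the order condition for $(<_{Aw},<_{Dw})$.
   Context: A language over a finite alphabet is a set of finite words containing the empty word, closed under taking factors and extendable (each $v\in L$ has letters $a,b$ with $av,vb\in L$). For a set of words $W$, $F(W)$ denotes the (not necessarily extendable) set of all factors of words of $W$; $F(u)=F(\{u\})$. In a set $L$ of words closed under factors, $v\in L$ is bispecial if at least two letters $x$ have $xv\in L$ and at least two letters $y$ have $vy\in L$; a bispecial $v$ satisfies the order condition for $(<_A,<_D)$ if whenever $xvy,x'vy'\in L$ with letters $x\ne x'$, $y\ne y'$, then $x<_Ax'$ iff $y<_Dy'$; $L$ satisfies the order condition if all its bispecial words (including the empty word) do. A suffix return word of $w$ in $L$ is $v\in L$ such that $wv\in L$ has exactly two occurrences of $w$, one as prefix, one as suffix; a prefix return word is $v\in L$ such that $vw\in L$ has exactly two occurrences of $w$, one as prefix, one as suffix. Derived orders on $\mathcal A'$: $a_i<_{Aw}a_j$ iff at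 the first position from the right where $w\phi a_i$ and $w\phi a_j$ (aligned at their last letters) differ, the letter of $w\phi a_i$ is $<_A$-smaller; $a_i<_{Dw}a_j$ iff at the first position from the left where $\phi a_iw$ and $\phi a_jw$ differ, the letter of $\phi a_iw$ is $<_D$-smaller. -}

module Defs where

open import Data.Nat using (ℕ)
open import Data.Fin using (Fin)
open import Data.List using (List; []; _∷_; _++_; [_]; reverse; concatMap)
open import Data.Product using (Σ; ∃; ∃-syntax; _×_; _,_)
open import Data.Sum using (_⊎_)
open import Relation.Binary.PropositionalEquality using (_≡_; _≢_)
open import Relation.Binary using (Rel)
open import Level using (0ℓ)
open import Function.Bundles using (_⇔_)

WordSet : Set → Set₁
WordSet A = List A → Set

Factor : {A : Set} → List A → List A → Set
Factor u x = ∃[ p ] ∃[ q ] (p ++ u ++ q ≡ x)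

F : {A : Set} → List A → WordSet A
F u x = Factor x u

record IsLanguage {A : Set} (L : WordSet A) : Set where
  field
    hasEmpty   : L []
    factorial  : ∀ {u x} → L x → Factor u x → L u
    extendable : ∀ {v} → L v → (∃[ a ] L (a ∷ v)) × (∃[ b ] L (v ++ [ b ]))

Bispecial : {A : Set} → WordSet A → List A → Set
Bispecial L v =
  (∃[ x ] ∃[ x' ] (x ≢ x' × L (x ∷ v) × L (x' ∷ v))) ×
  (∃[ y ] ∃[ y' ] (y ≢ y' × L (v ++ [ y ]) × L (v ++ [ y' ])))

OrderCondition : {A : Set} → Rel A 0ℓ → Rel A 0ℓ → WordSet A → Set
OrderCondition {A} _<A_ _<D_ L =
  ∀ (v : List A) → Bispecial L v →
  ∀ (x x' y y' : A) → x ≢ x' → y ≢ y' →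
  L (x ∷ v ++ [ y ]) → L (x' ∷ v ++ [ y' ]) →
  (x <A x') ⇔ (y <D y')

FirstDiffLess : {A : Set} → Rel A 0ℓ → List A → List A → Set
FirstDiffLess {A} R u u' =
  ∃[ p ] ∃[ a ] ∃[ a' ] ∃[ q ] ∃[ q' ]
    (u ≡ p ++ a ∷ q × u' ≡ p ++ a' ∷ q' × a ≢ a' × R a a')

-- suffix return word v of w in L: v ∈ L, wv ∈ L, and wv has exactly two
-- occurrences of w, one as prefix and one as suffix.
SuffixReturn : {A : Set} → WordSet A → List A → List A → Set
SuffixReturn L w v =
  L v × L (w ++ v) ×
  v ≢ [] ×                                        -- the two occurrences are distinct
  (∃[ p ] (p ++ w ≡ w ++ v)) ×
  (∀ p q → p ++ w ++ q ≡ w ++ v → p ≡ [] ⊎ q ≡ [])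

-- prefix return word v of w in L: v ∈ L, vw ∈ L, and vw has exactly two
-- occurrences of w, one as prefix and one as suffix.
PrefixReturn : {A : Set} → WordSet A → List A → List A → Set
PrefixReturn L w v =
  L v × L (v ++ w) ×
  v ≢ [] ×
  (∃[ q ] (w ++ q ≡ v ++ w)) ×
  (∀ p q → p ++ w ++ q ≡ v ++ w → p ≡ [] ⊎ q ≡ [])

φ : {A : Set} {s : ℕ} → (Fin s → List A) → List (Fin s) → List A
φ U v = concatMap U v

-- derived orders with respect to w
-- aᵢ <Aw aⱼ : first difference from the right (aligned at last letters)
--             of wφaᵢ and wφaⱼ has the letter of wφaᵢ <A-smaller
DerivedA : {A : Set} {s : ℕ} → Rel A 0ℓ → List A → (Fin s → List A) → Rel (Fin s) 0ℓ
DerivedA _<A_ w U i j = FirstDiffLess _<A_ (reverse (w ++ U i)) (reverse (w ++ U j))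

DerivedD : {A : Set} {s : ℕ} → Rel A 0ℓ → List A → (Fin s → List A) → Rel (Fin s) 0ℓ
DerivedD _<D_ w U i j = FirstDiffLess _<D_ (U i ++ w) (U j ++ w)

-- Write Vₐ for the word with Vₐ w = w Uₐ. Then w φ(v) = V_{a₁} ⋯ V_{aₙ} w, the Uₐ form a prefix code, and
-- the occurrences of w in w φ(v) are exactly those following some V_{a₁} ⋯ V_{aₖ}. Hence an extension a u b of u
-- in v yields the extension x (T φ(u) P) y in w φ(v), where x is the letter before the longest common suffix T of
-- w Uₐ and w U_{a′}, and y the letter after the longest common prefix P of U_b and U_{b′}: these are exactly the
-- letters compared by the derived orders. Conversely, an extension x z y in w φ(v) lies in w or in some w Uₐ,
-- hence in L, unless w is a factor of z; then the first occurrence of w in z sits at a block boundary, and by the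
-- prefix-code property two extensions x z y, x′ z y′ come from extensions a u b, a′ u b′ of one factor u of v.
-- Reversing all words swaps the two orders and exchanges prefix and suffix return words.

module Submission where

open import Defs
open import Data.Nat using (ℕ; _+_; _≤_)
open import Data.Nat.Properties using (+-assoc; +-comm; +-identityʳ; +-cancelˡ-≡; m+n≡0⇒m≡0; m+n≡0⇒n≡0)
open import Data.Fin as Fin using (Fin)
open import Data.List using (List; []; _∷_; _++_; [_]; _∷ʳ_; reverse; length; initLast; _∷ʳ′_)
open import Data.List.Properties
  using (++-assoc; ++-identityʳ; ++-identityˡ-unique; ++-identityʳ-unique; ++-cancelˡ; ++-conicalˡ; ++-conicalʳ;
         ∷-injective; ∷-injectiveˡ; ∷-injectiveʳ; ∷ʳ-injectiveˡ; length-++; reverse-++; reverse-involutive;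
         reverse-injective; unfold-reverse; concatMap-++; ++-monoid)
open import Data.Product using (∃-syntax; _×_; _,_; proj₁; proj₂)
open import Data.Sum using (_⊎_; inj₁; inj₂)
open import Data.Empty using (⊥-elim)
open import Relation.Nullary using (¬_; Dec; yes; no)
open import Relation.Binary using (Rel; DecidableEquality; IsStrictTotalOrder)
open import Relation.Binary.PropositionalEquality using (_≡_; _≢_; refl; sym; trans; cong; cong₂; subst; module ≡-Reasoning)
open import Level using (0ℓ)
open import Function.Base using (_∘_)
open import Function.Bundles using (_⇔_; mk⇔; Equivalence)
open import Function.Definitions using (Injective)
import Function.Properties.Equivalence as ⇔
open import Tactic.MonoidSolver using (solve)

module _ {A : Set} where

  ++-equidivisible : (a b c d : List A) → a ++ b ≡ c ++ d →
    (∃[ m ] (c ≡ a ++ m × b ≡ m ++ d)) ⊎ (∃[ m ] (a ≡ c ++ m × d ≡ m ++ b))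
  ++-equidivisible []      b c       d eq = inj₁ (c , refl , eq)
  ++-equidivisible (x ∷ a) b []      d eq = inj₂ (x ∷ a , refl , sym eq)
  ++-equidivisible (x ∷ a) b (y ∷ c) d eq with refl , eq′ ← ∷-injective eq
    with ++-equidivisible a b c d eq′
  ... | inj₁ (m , e₁ , e₂) = inj₁ (m , cong (x ∷_) e₁ , e₂)
  ... | inj₂ (m , e₁ , e₂) = inj₂ (m , cong (x ∷_) e₁ , e₂)

  ++-∷≢[] : ∀ (X : List A) {y Y} → X ++ y ∷ Y ≢ []
  ++-∷≢[] []      ()
  ++-∷≢[] (_ ∷ _) ()

  length≡0⇒[] : (xs : List A) → length xs ≡ 0 → xs ≡ []
  length≡0⇒[] []      _  = refl
  length≡0⇒[] (_ ∷ _) ()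

  ++-infix-self : (p w q : List A) → p ++ w ++ q ≡ w → p ≡ [] × q ≡ []
  ++-infix-self p w q eq =
    length≡0⇒[] p (m+n≡0⇒n≡0 (length q) q+p≡0) , length≡0⇒[] q (m+n≡0⇒m≡0 (length q) q+p≡0)
    where
    open ≡-Reasoning
    q+p≡0 : length q + length p ≡ 0
    q+p≡0 = +-cancelˡ-≡ (length w) _ _ (begin
      length w + (length q + length p) ≡⟨ +-assoc (length w) (length q) (length p) ⟨
      length w + length q + length p   ≡⟨ +-comm _ (length p) ⟩
      length p + (length w + length q) ≡⟨ cong (length p +_) (length-++ w) ⟨
      length p + length (w ++ q)       ≡⟨ length-++ p ⟨
      length (p ++ w ++ q)             ≡⟨ cong length eq ⟩
      length w                         ≡⟨ +-identityʳ (length w) ⟨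
      length w + 0                     ∎)

  reverse-++-∷ : (c : List A) (x : A) (T : List A) → reverse (c ++ x ∷ T) ≡ reverse T ++ x ∷ reverse c
  reverse-++-∷ c x T = begin
    reverse (c ++ x ∷ T)              ≡⟨ reverse-++ c (x ∷ T) ⟩
    reverse (x ∷ T) ++ reverse c      ≡⟨ cong (_++ reverse c) (unfold-reverse x T) ⟩
    (reverse T ∷ʳ x) ++ reverse c     ≡⟨ ++-assoc (reverse T) [ x ] (reverse c) ⟩
    reverse T ++ x ∷ reverse c        ∎
    where open ≡-Reasoning

  reverse-decompose : ∀ {l} p (x : A) q → reverse l ≡ p ++ x ∷ q → l ≡ reverse q ++ x ∷ reverse p
  reverse-decompose {l} p x q e =
    trans (sym (reverse-involutive l)) (trans (cong reverse e) (reverse-++-∷ p x q))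

  reverse-prefix : ∀ {l l′ : List A} k → reverse l′ ≡ reverse l ++ k → l′ ≡ reverse k ++ l
  reverse-prefix {l} {l′} k e = begin
    l′                              ≡⟨ reverse-involutive l′ ⟨
    reverse (reverse l′)            ≡⟨ cong reverse e ⟩
    reverse (reverse l ++ k)        ≡⟨ reverse-++ (reverse l) k ⟩
    reverse k ++ reverse (reverse l) ≡⟨ cong (reverse k ++_) (reverse-involutive l) ⟩
    reverse k ++ l                  ∎
    where open ≡-Reasoning

  reverse-reverse-++ : (u v : List A) → reverse (reverse u ++ reverse v) ≡ v ++ u
  reverse-reverse-++ u v = trans (cong reverse (sym (reverse-++ v u))) (reverse-involutive (v ++ u))

  Factor-trans : {t u X : List A} → Factor t u → Factor u X → Factor t X
  Factor-trans {t} (α , β , refl) (γ , δ , refl) = γ ++ α , β ++ δ , solve (++-monoid A)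

  Factor-reverse : {t X : List A} → Factor t X → Factor (reverse t) (reverse X)
  Factor-reverse {t} (α , β , refl) = reverse β , reverse α , (begin
    reverse β ++ reverse t ++ reverse α   ≡⟨ ++-assoc (reverse β) (reverse t) (reverse α) ⟨
    (reverse β ++ reverse t) ++ reverse α ≡⟨ cong (_++ reverse α) (reverse-++ t β) ⟨
    reverse (t ++ β) ++ reverse α         ≡⟨ reverse-++ α (t ++ β) ⟨
    reverse (α ++ t ++ β)                 ∎)
    where open ≡-Reasoning

  Factor-straddle-split : ∀ {x y : A} {z} μ Y ν → x ∷ z ++ [ y ] ≡ μ ++ Y ++ ν →
    μ ≡ [] ⊎ ν ≡ [] ⊎ Factor Y z
  Factor-straddle-split []      Y ν e = inj₁ refl
  Factor-straddle-split {z = z} (_ ∷ μ) Y ν e with initLast ν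
  ... | []       = inj₂ (inj₁ refl)
  ... | ν′ ∷ʳ′ n = inj₂ (inj₂ (μ , ν′ , sym (∷ʳ-injectiveˡ z (μ ++ Y ++ ν′)
                     (trans (∷-injectiveʳ e) (solve (++-monoid A))))))

  Factor-straddle : ∀ {x y : A} {z} X Y Z → Factor (x ∷ z ++ [ y ]) (X ++ Y ++ Z) →
    Factor (x ∷ z ++ [ y ]) (X ++ Y) ⊎ Factor (x ∷ z ++ [ y ]) (Y ++ Z) ⊎ Factor Y z
  Factor-straddle {x} {y} {z} X Y Z (α , β , e) with ++-equidivisible α (t ++ β) X (Y ++ Z) e
    where t = x ∷ z ++ [ y ]
  ... | inj₂ (μ , refl , e₁) = inj₂ (inj₁ (μ , β , sym e₁))
  ... | inj₁ (μ , refl , e₁) with ++-equidivisible (x ∷ z ++ [ y ]) β (μ ++ Y) Z (trans e₁ (sym (++-assoc μ Y Z)))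
  ...   | inj₁ (ν , e₂ , _) = inj₁ (α , ν , trans (cong (α ++_) (sym e₂)) (sym (++-assoc α μ Y)))
  ...   | inj₂ (ν , e₂ , refl) with Factor-straddle-split μ Y ν (trans e₂ (++-assoc μ Y ν))
  ...     | inj₁ refl        = inj₂ (inj₁ ([] , β , trans (cong (_++ β) e₂) (++-assoc Y ν β)))
  ...     | inj₂ (inj₁ refl) = inj₁ (α , [] , trans (cong (λ t → α ++ t ++ []) e₂) (solve (++-monoid A)))
  ...     | inj₂ (inj₂ Y⊑z)  = inj₂ (inj₂ Y⊑z)

  OccursOnlyAsSuffix : List A → List A → Set
  OccursOnlyAsSuffix w t = ∀ p q → p ++ w ++ q ≡ t → q ≡ []

  prefix? : DecidableEquality A → (w t : List A) → Dec (∃[ R ] (t ≡ w ++ R))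
  prefix? _≟_ []      t       = yes (t , refl)
  prefix? _≟_ (a ∷ w) []      = no λ ()
  prefix? _≟_ (a ∷ w) (b ∷ t) with a ≟ b | prefix? _≟_ w t
  ... | no a≢b    | _            = no λ (_ , e) → a≢b (sym (∷-injectiveˡ e))
  ... | yes refl  | yes (R , e)  = yes (R , cong (a ∷_) e)
  ... | yes refl  | no w⋢t       = no λ (R , e) → w⋢t (R , ∷-injectiveʳ e)

  firstOccurrence : DecidableEquality A → (w z : List A) →
    (∃[ S ] ∃[ R ] (z ≡ S ++ w ++ R × OccursOnlyAsSuffix w (S ++ w))) ⊎ ¬ Factor w z
  firstOccurrence _≟_ w z with prefix? _≟_ w z
  ... | yes (R , e) = inj₁ ([] , R , e , λ p q e′ → proj₂ (++-infix-self p w q e′))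
  firstOccurrence _≟_ w [] | no w⋢[] =
    inj₂ λ (α , β , e) → w⋢[] ([] , sym (trans (++-identityʳ w) (++-conicalˡ w β (++-conicalʳ α (w ++ β) e))))
  firstOccurrence _≟_ w (c ∷ z) | no w⋢cz with firstOccurrence _≟_ w z
  ... | inj₂ w∉z = inj₂ λ where
    ([]    , β , e) → w⋢cz (β , sym e)
    (_ ∷ α , β , e) → w∉z (α , β , ∷-injectiveʳ e)
  ... | inj₁ (S , R , refl , only) = inj₁ (c ∷ S , R , refl , only′)
    where
    only′ : OccursOnlyAsSuffix w (c ∷ S ++ w)
    only′ []      q e = ⊥-elim (w⋢cz (q ++ R , trans (cong (c ∷_) (sym (++-assoc S w R)))
                          (trans (cong (_++ R) (sym e)) (++-assoc w q R))))
    only′ (_ ∷ p) q e = only p q (∷-injectiveʳ e)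

  Diverge : List A → List A → A → A → Set
  Diverge l l′ x x′ = ∃[ p ] ∃[ q ] ∃[ q′ ] (l ≡ p ++ x ∷ q × l′ ≡ p ++ x′ ∷ q′)

  Diverge-++ʳ : ∀ {l l′ x x′} m → Diverge l l′ x x′ → Diverge (l ++ m) (l′ ++ m) x x′
  Diverge-++ʳ {x = x} {x′} m (p , q , q′ , refl , refl) =
    p , q ++ m , q′ ++ m , ++-assoc p (x ∷ q) m , ++-assoc p (x′ ∷ q′) m

  Diverge⇒≢ : ∀ {B : Set} (f : B → List A) {a a′ x x′} → x ≢ x′ → Diverge (f a) (f a′) x x′ →
    a ≢ a′
  Diverge⇒≢ f x≢x′ (p , _ , _ , e , e′) refl =
    x≢x′ (∷-injectiveˡ (++-cancelˡ p _ _ (trans (sym e) e′)))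

  diverge-unique : ∀ {x x′ b b′ : A} p q q′ p₂ q₂ q₂′ → x ≢ x′ → b ≢ b′ →
    p ++ x ∷ q ≡ p₂ ++ b ∷ q₂ → p ++ x′ ∷ q′ ≡ p₂ ++ b′ ∷ q₂′ → x ≡ b × x′ ≡ b′
  diverge-unique []      _ _ []       _ _ _    _    e e′ = ∷-injectiveˡ e , ∷-injectiveˡ e′
  diverge-unique []      _ _ (_ ∷ _)  _ _ x≢x′ _    e e′ =
    ⊥-elim (x≢x′ (trans (∷-injectiveˡ e) (sym (∷-injectiveˡ e′))))
  diverge-unique (_ ∷ _) _ _ []       _ _ _    b≢b′ e e′ =
    ⊥-elim (b≢b′ (trans (sym (∷-injectiveˡ e)) (∷-injectiveˡ e′)))
  diverge-unique (_ ∷ p) q q′ (_ ∷ p₂) q₂ q₂′ x≢x′ b≢b′ e e′ =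
    diverge-unique p q q′ p₂ q₂ q₂′ x≢x′ b≢b′ (∷-injectiveʳ e) (∷-injectiveʳ e′)

  FirstDiffLess-Diverge : (R : Rel A 0ℓ) {l l′ : List A} {x x′ : A} → x ≢ x′ → Diverge l l′ x x′ →
    FirstDiffLess R l l′ ⇔ R x x′
  FirstDiffLess-Diverge R x≢x′ (p , q , q′ , refl , refl) =
    mk⇔ to (λ r → p , _ , _ , q , q′ , refl , refl , x≢x′ , r)
    where
    to : FirstDiffLess R _ _ → R _ _
    to (p₂ , _ , _ , q₂ , q₂′ , e , e′ , b≢b′ , r)
      with refl , refl ← diverge-unique p q q′ p₂ q₂ q₂′ x≢x′ b≢b′ e e′ = r

  FirstDiffLess-cong : (R : Rel A 0ℓ) {l₁ l₂ l₁′ l₂′ : List A} → l₁ ≡ l₂ → l₁′ ≡ l₂′ →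
    FirstDiffLess R l₁ l₁′ ⇔ FirstDiffLess R l₂ l₂′
  FirstDiffLess-cong R refl refl = ⇔.refl

  prefix-or-Diverge : DecidableEquality A → (l l′ : List A) →
    (∃[ k ] (l′ ≡ l ++ k)) ⊎ (∃[ k ] (l ≡ l′ ++ k)) ⊎ (∃[ x ] ∃[ x′ ] (x ≢ x′ × Diverge l l′ x x′))
  prefix-or-Diverge _≟_ []      l′      = inj₁ (l′ , refl)
  prefix-or-Diverge _≟_ (x ∷ l) []      = inj₂ (inj₁ (x ∷ l , refl))
  prefix-or-Diverge _≟_ (x ∷ l) (y ∷ l′) with x ≟ y
  ... | no x≢y   = inj₂ (inj₂ (x , y , x≢y , [] , l , l′ , refl , refl))
  ... | yes refl with prefix-or-Diverge _≟_ l l′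
  ...   | inj₁ (k , e)        = inj₁ (k , cong (x ∷_) e)
  ...   | inj₂ (inj₁ (k , e)) = inj₂ (inj₁ (k , cong (x ∷_) e))
  ...   | inj₂ (inj₂ (z , z′ , z≢z′ , p , q , q′ , e , e′)) =
          inj₂ (inj₂ (z , z′ , z≢z′ , x ∷ p , q , q′ , cong (x ∷_) e , cong (x ∷_) e′))

  FactorClosed : WordSet A → Set
  FactorClosed S = ∀ {u t} → S t → Factor u t → S u

  F-factorClosed : (X : List A) → FactorClosed (F X)
  F-factorClosed X X⊒t u⊑t = Factor-trans u⊑t X⊒t

  -- The order condition without its bispeciality hypothesis; on factor-closed sets the
  -- two extensions x v y, x′ v y′ already witness that v is bispecial.
  OrderCondition′ : Rel A 0ℓ → Rel A 0ℓ → WordSet A → Set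
  OrderCondition′ _<₁_ _<₂_ S = ∀ v x x′ y y′ → x ≢ x′ → y ≢ y′ →
    S (x ∷ v ++ [ y ]) → S (x′ ∷ v ++ [ y′ ]) → (x <₁ x′) ⇔ (y <₂ y′)

  bispecial-from-extensions : {S : WordSet A} → FactorClosed S → ∀ {v x x′ y y′} → x ≢ x′ → y ≢ y′ →
    S (x ∷ v ++ [ y ]) → S (x′ ∷ v ++ [ y′ ]) → Bispecial S v
  bispecial-from-extensions closed {x = x} {x′} {y} {y′} x≢x′ y≢y′ xvy x′vy′ =
    (x , x′ , x≢x′ , closed xvy ([] , [ y ] , refl) , closed x′vy′ ([] , [ y′ ] , refl)) ,
    (y , y′ , y≢y′ , closed xvy ([ x ] , [] , cong (x ∷_) (++-identityʳ _)) ,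
                     closed x′vy′ ([ x′ ] , [] , cong (x′ ∷_) (++-identityʳ _)))

  OrderCondition⇔OrderCondition′ : {R Q : Rel A 0ℓ} {S : WordSet A} → FactorClosed S →
    OrderCondition R Q S ⇔ OrderCondition′ R Q S
  OrderCondition⇔OrderCondition′ closed = mk⇔
    (λ oc v x x′ y y′ x≢x′ y≢y′ e e′ →
       oc v (bispecial-from-extensions closed x≢x′ y≢y′ e e′) x x′ y y′ x≢x′ y≢y′ e e′)
    (λ oc′ v _ → oc′ v)

  OrderCondition′-cong : {R R′ Q Q′ : Rel A 0ℓ} {S : WordSet A} →
    (∀ a b → R a b ⇔ R′ a b) → (∀ a b → Q a b ⇔ Q′ a b) →
    OrderCondition′ R Q S ⇔ OrderCondition′ R′ Q′ S
  OrderCondition′-cong {S = S} R⇔R′ Q⇔Q′ =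
    mk⇔ (transport {S = S} R⇔R′ Q⇔Q′)
        (transport {S = S} (λ a b → ⇔.sym (R⇔R′ a b)) (λ a b → ⇔.sym (Q⇔Q′ a b)))
    where
    transport : ∀ {R R′ Q Q′ S} → (∀ a b → R a b ⇔ R′ a b) → (∀ a b → Q a b ⇔ Q′ a b) →
      OrderCondition′ R Q S → OrderCondition′ R′ Q′ S
    transport R⇔R′ Q⇔Q′ oc v x x′ y y′ x≢x′ y≢y′ e e′ =
      ⇔.trans (⇔.sym (R⇔R′ x x′)) (⇔.trans (oc v x x′ y y′ x≢x′ y≢y′ e e′) (Q⇔Q′ y y′))

  OrderCondition′-mono : {R Q : Rel A 0ℓ} {S S′ : WordSet A} → (∀ {t} → S′ t → S t) →
    OrderCondition′ R Q S → OrderCondition′ R Q S′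
  OrderCondition′-mono S′⊆S oc v x x′ y y′ x≢x′ y≢y′ e e′ =
    oc v x x′ y y′ x≢x′ y≢y′ (S′⊆S e) (S′⊆S e′)

  OrderCondition′-reverse : {R Q : Rel A 0ℓ} {S : WordSet A} →
    OrderCondition′ R Q S → OrderCondition′ Q R (S ∘ reverse)
  OrderCondition′-reverse {S = S} oc v x x′ y y′ x≢x′ y≢y′ e e′ =
    ⇔.sym (oc (reverse v) y y′ x x′ y≢y′ x≢x′
                (subst S (reverse-extension x v y) e) (subst S (reverse-extension x′ v y′) e′))
    where
    reverse-extension : ∀ x v y → reverse (x ∷ v ++ [ y ]) ≡ y ∷ reverse v ++ [ x ]
    reverse-extension x v y =
      trans (reverse-++-∷ [] x (v ++ [ y ])) (cong (_++ [ x ]) (reverse-++ v [ y ]))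

  OrderCondition′-F-reverse : {R Q : Rel A 0ℓ} (X : List A) →
    OrderCondition′ R Q (F X) ⇔ OrderCondition′ Q R (F (reverse X))
  OrderCondition′-F-reverse X = mk⇔ (F-reverse X)
    (subst (λ Y → OrderCondition′ _ _ (F Y)) (reverse-involutive X) ∘ F-reverse (reverse X))
    where
    F-reverse : ∀ {R Q} X → OrderCondition′ R Q (F X) → OrderCondition′ Q R (F (reverse X))
    F-reverse X oc =
      OrderCondition′-mono {S = F X ∘ reverse} {S′ = F (reverse X)} reverse-into
        (OrderCondition′-reverse {S = F X} oc)
      where
      reverse-into : ∀ {t} → Factor t (reverse X) → Factor (reverse t) X
      reverse-into {t} t⊑X′ = subst (Factor (reverse t)) (reverse-involutive X) (Factor-reverse t⊑X′)

module _ {A : Set} {s : ℕ} where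

  φ-reverse : (f : Fin s → List A) (v : List (Fin s)) → reverse (φ f v) ≡ φ (reverse ∘ f) (reverse v)
  φ-reverse f []      = refl
  φ-reverse f (a ∷ v) = begin
    reverse (f a ++ φ f v)              ≡⟨ reverse-++ (f a) (φ f v) ⟩
    reverse (φ f v) ++ reverse (f a)    ≡⟨ cong₂ _++_ (φ-reverse f v) (sym (++-identityʳ _)) ⟩
    φ g (reverse v) ++ φ g [ a ]        ≡⟨ concatMap-++ g (reverse v) [ a ] ⟨
    φ g (reverse v ++ [ a ])            ≡⟨ cong (φ g) (unfold-reverse a v) ⟨
    φ g (reverse (a ∷ v))               ∎
    where
    open ≡-Reasoning
    g = reverse ∘ f

  φ-∷ʳ : (f : Fin s → List A) (v : List (Fin s)) (a : Fin s) → φ f (v ∷ʳ a) ≡ φ f v ++ f a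
  φ-∷ʳ f v a = trans (concatMap-++ f v [ a ]) (cong (φ f v ++_) (++-identityʳ (f a)))

  φ-split : (f : Fin s → List A) (v : List (Fin s)) (R : List A) (y : A) (β : List A) →
    R ++ y ∷ β ≡ φ f v →
    ∃[ u ] ∃[ b ] ∃[ v′ ] ∃[ P ] ∃[ d ] (v ≡ u ++ b ∷ v′ × R ≡ φ f u ++ P × f b ≡ P ++ y ∷ d)
  φ-split f []      R y β e = ⊥-elim (++-∷≢[] R e)
  φ-split f (c ∷ v) R y β e with ++-equidivisible (f c) (φ f v) R (y ∷ β) (sym e)
  ... | inj₁ (m , refl , e₂) with u , b , v′ , P , d , refl , refl , e₃ ← φ-split f v m y β (sym e₂) =
        c ∷ u , b , v′ , P , d , refl , sym (++-assoc (f c) (φ f u) P) , e₃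
  ... | inj₂ (_ ∷ m , e₁ , e₂) with refl , _ ← ∷-injective e₂ = [] , c , v , R , m , refl , refl , e₁
  ... | inj₂ ([] , e₁ , e₂) with u , b , v′ , P , d , refl , e₃ , e₄ ← φ-split f v [] y β e₂ =
        c ∷ u , b , v′ , P , d , refl , R≡ , e₄
    where
    open ≡-Reasoning
    R≡ : R ≡ φ f (c ∷ u) ++ P
    R≡ = begin
      R                    ≡⟨ ++-identityʳ R ⟨
      R ++ []              ≡⟨ e₁ ⟨
      f c                  ≡⟨ ++-identityʳ (f c) ⟨
      f c ++ []            ≡⟨ cong (f c ++_) e₃ ⟩
      f c ++ φ f u ++ P    ≡⟨ ++-assoc (f c) (φ f u) P ⟨
      φ f (c ∷ u) ++ P     ∎

module SuffixReturnCode {A : Set} (_≟_ : DecidableEquality A) (_<A_ _<D_ : Rel A 0ℓ)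
  (L : WordSet A) (L-closed : FactorClosed L) (L-order : OrderCondition′ _<A_ _<D_ L)
  (w : List A) (Lw : L w) {s : ℕ} (U : Fin s → List A) (U-injective : Injective _≡_ _≡_ U)
  (U-return : ∀ a → SuffixReturn L w (U a)) where

  wU∈L : ∀ a → L (w ++ U a)
  wU∈L a = proj₁ (proj₂ (U-return a))

  U≢[] : ∀ a → U a ≢ []
  U≢[] a = proj₁ (proj₂ (proj₂ (U-return a)))

  V : Fin s → List A
  V a = proj₁ (proj₁ (proj₂ (proj₂ (proj₂ (U-return a)))))

  V-w≡w-U : ∀ a → V a ++ w ≡ w ++ U a
  V-w≡w-U a = proj₂ (proj₁ (proj₂ (proj₂ (proj₂ (U-return a)))))

  w-in-wU : ∀ a p q → p ++ w ++ q ≡ w ++ U a → p ≡ [] ⊎ q ≡ []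
  w-in-wU a = proj₂ (proj₂ (proj₂ (proj₂ (U-return a))))

  w-φ-∷ : ∀ a v → w ++ φ U (a ∷ v) ≡ V a ++ w ++ φ U v
  w-φ-∷ a v = begin
    w ++ U a ++ φ U v     ≡⟨ ++-assoc w (U a) (φ U v) ⟨
    (w ++ U a) ++ φ U v   ≡⟨ cong (_++ φ U v) (V-w≡w-U a) ⟨
    (V a ++ w) ++ φ U v   ≡⟨ ++-assoc (V a) w (φ U v) ⟩
    V a ++ w ++ φ U v     ∎
    where open ≡-Reasoning

  w-φ-conjugate : ∀ v → w ++ φ U v ≡ φ V v ++ w
  w-φ-conjugate []      = ++-identityʳ w
  w-φ-conjugate (a ∷ v) = begin
    w ++ φ U (a ∷ v)      ≡⟨ w-φ-∷ a v ⟩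
    V a ++ w ++ φ U v     ≡⟨ cong (V a ++_) (w-φ-conjugate v) ⟩
    V a ++ φ V v ++ w     ≡⟨ ++-assoc (V a) (φ V v) w ⟨
    φ V (a ∷ v) ++ w      ∎
    where open ≡-Reasoning

  U-prefixFree : ∀ a b m → U a ++ m ≡ U b → m ≡ []
  U-prefixFree a b m e with w-in-wU b (V a) m (begin
      V a ++ w ++ m     ≡⟨ ++-assoc (V a) w m ⟨
      (V a ++ w) ++ m   ≡⟨ cong (_++ m) (V-w≡w-U a) ⟩
      (w ++ U a) ++ m   ≡⟨ ++-assoc w (U a) m ⟩
      w ++ U a ++ m     ≡⟨ cong (w ++_) e ⟩
      w ++ U b          ∎)
    where open ≡-Reasoning
  ... | inj₂ m≡[]  = m≡[]
  ... | inj₁ Va≡[] = ⊥-elim (U≢[] a (++-identityʳ-unique w (trans (cong (_++ w) (sym Va≡[])) (V-w≡w-U a))))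

  U-prefix-injective : ∀ a b X Y → U a ++ X ≡ U b ++ Y → a ≡ b
  U-prefix-injective a b X Y e with ++-equidivisible (U a) X (U b) Y e
  ... | inj₁ (m , Ub≡ , _) = U-injective (trans (sym (++-identityʳ (U a)))
                               (trans (cong (U a ++_) (sym (U-prefixFree a b m (sym Ub≡)))) (sym Ub≡)))
  ... | inj₂ (m , Ua≡ , _) = U-injective (trans Ua≡
                               (trans (cong (U b ++_) (U-prefixFree b a m (sym Ua≡))) (++-identityʳ (U b))))

  φ-parse-unique : ∀ u u′ P P′ {b b′ y y′ d d′} → φ U u ++ P ≡ φ U u′ ++ P′ →
    U b ≡ P ++ y ∷ d → U b′ ≡ P′ ++ y′ ∷ d′ → u ≡ u′ × P ≡ P′
  φ-parse-unique []      []       P P′ e _ _ = refl , e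
  φ-parse-unique []      (c ∷ u′) P P′ {b} {y = y} {d = d} e Ub≡ _ =
    ⊥-elim (++-∷≢[] (φ U u′ ++ P′) (U-prefixFree c b _ (sym (begin
      U b                              ≡⟨ Ub≡ ⟩
      P ++ y ∷ d                       ≡⟨ cong (_++ y ∷ d) e ⟩
      ((U c ++ φ U u′) ++ P′) ++ y ∷ d ≡⟨ solve (++-monoid A) ⟩
      U c ++ (φ U u′ ++ P′) ++ y ∷ d   ∎))))
    where open ≡-Reasoning
  φ-parse-unique (c ∷ u) []       P P′ e Ub≡ Ub′≡ =
    let u′≡u , P′≡P = φ-parse-unique [] (c ∷ u) P′ P (sym e) Ub′≡ Ub≡ in sym u′≡u , sym P′≡P
  φ-parse-unique (c ∷ u) (c′ ∷ u′) P P′ e Ub≡ Ub′≡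
    with e′ ← trans (sym (++-assoc (U c) (φ U u) P)) (trans e (++-assoc (U c′) (φ U u′) P′))
    with refl ← U-prefix-injective c c′ _ _ e′
    with refl , refl ← φ-parse-unique u u′ P P′ (++-cancelˡ (U c) _ _ e′) Ub≡ Ub′≡ = refl , refl

  wU-suffix-injective : ∀ a a′ k → w ++ U a′ ≡ k ++ w ++ U a → a′ ≡ a
  wU-suffix-injective a a′ k e with w-in-wU a′ k (U a) (sym e)
  ... | inj₁ refl = U-injective (++-cancelˡ w _ _ e)
  ... | inj₂ Ua≡[] = ⊥-elim (U≢[] a Ua≡[])

  returns-diverge-from-right : ∀ {a a′} → a ≢ a′ →
    ∃[ x ] ∃[ x′ ] (x ≢ x′ × Diverge (reverse (w ++ U a)) (reverse (w ++ U a′)) x x′)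
  returns-diverge-from-right {a} {a′} a≢a′
    with prefix-or-Diverge _≟_ (reverse (w ++ U a)) (reverse (w ++ U a′))
  ... | inj₁ (k , e)        = ⊥-elim (a≢a′ (sym (wU-suffix-injective a a′ (reverse k) (reverse-prefix k e))))
  ... | inj₂ (inj₁ (k , e)) = ⊥-elim (a≢a′ (wU-suffix-injective a′ a (reverse k) (reverse-prefix k e)))
  ... | inj₂ (inj₂ d)       = d

  returns-diverge-from-left : ∀ {b b′} → b ≢ b′ →
    ∃[ y ] ∃[ y′ ] (y ≢ y′ × Diverge (U b) (U b′) y y′)
  returns-diverge-from-left {b} {b′} b≢b′ with prefix-or-Diverge _≟_ (U b) (U b′)
  ... | inj₁ (k , e)        = ⊥-elim (b≢b′ (U-prefix-injective b b′ k [] (trans (sym e) (sym (++-identityʳ _)))))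
  ... | inj₂ (inj₁ (k , e)) =
        ⊥-elim (b≢b′ (sym (U-prefix-injective b′ b k [] (trans (sym e) (sym (++-identityʳ _))))))
  ... | inj₂ (inj₂ d)       = d

  Factor-w-φ : ∀ {t v} → F v t → Factor (w ++ φ U t) (w ++ φ U v)
  Factor-w-φ {t} (α , β , refl) = φ V α , φ U β , (begin
    φ V α ++ (w ++ φ U t) ++ φ U β   ≡⟨ solve (++-monoid A) ⟩
    (φ V α ++ w) ++ φ U t ++ φ U β   ≡⟨ cong (_++ φ U t ++ φ U β) (w-φ-conjugate α) ⟨
    (w ++ φ U α) ++ φ U t ++ φ U β   ≡⟨ ++-assoc w (φ U α) _ ⟩
    w ++ φ U α ++ φ U t ++ φ U β     ≡⟨ cong (λ m → w ++ φ U α ++ m) (concatMap-++ U t β) ⟨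
    w ++ φ U α ++ φ U (t ++ β)       ≡⟨ cong (w ++_) (concatMap-++ U α (t ++ β)) ⟨
    w ++ φ U (α ++ t ++ β)           ∎)
    where open ≡-Reasoning

  image-extension : ∀ {v a u b p x q P y d} → F v (a ∷ u ++ [ b ]) →
    reverse (w ++ U a) ≡ p ++ x ∷ q → U b ≡ P ++ y ∷ d →
    F (w ++ φ U v) (x ∷ (reverse p ++ φ U u ++ P) ++ [ y ])
  image-extension {a = a} {u} {b} {p} {x} {q} {P} {y} {d} aub⊑v wUa≡ Ub≡ =
    Factor-trans (reverse q , d , image) (Factor-w-φ aub⊑v)
    where
    open ≡-Reasoning
    reassoc : ∀ Q X T Φ P Y D → Q ++ (X ++ (T ++ Φ ++ P) ++ Y) ++ D ≡ (Q ++ X ++ T) ++ Φ ++ P ++ Y ++ D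
    reassoc _ _ _ _ _ _ _ = solve (++-monoid A)
    image : reverse q ++ (x ∷ (reverse p ++ φ U u ++ P) ++ [ y ]) ++ d ≡ w ++ φ U (a ∷ u ++ [ b ])
    image = begin
      reverse q ++ (x ∷ (reverse p ++ φ U u ++ P) ++ [ y ]) ++ d
        ≡⟨ reassoc (reverse q) [ x ] (reverse p) (φ U u) P [ y ] d ⟩
      (reverse q ++ x ∷ reverse p) ++ φ U u ++ P ++ y ∷ d
        ≡⟨ cong₂ (λ l m → l ++ φ U u ++ m) (reverse-decompose {l = w ++ U a} p x q wUa≡) Ub≡ ⟨
      (w ++ U a) ++ φ U u ++ U b
        ≡⟨ cong (λ m → (w ++ U a) ++ φ U u ++ m) (++-identityʳ (U b)) ⟨
      (w ++ U a) ++ φ U u ++ φ U [ b ]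
        ≡⟨ cong ((w ++ U a) ++_) (concatMap-++ U u [ b ]) ⟨
      (w ++ U a) ++ φ U (u ++ [ b ])
        ≡⟨ ++-assoc w (U a) _ ⟩
      w ++ φ U (a ∷ u ++ [ b ])
        ∎

  forward : ∀ v → OrderCondition′ _<A_ _<D_ (F (w ++ φ U v)) →
    OrderCondition′ (DerivedA _<A_ w U) (DerivedD _<D_ w U) (F v)
  forward v oc u a a′ b b′ a≢a′ b≢b′ aub⊑v a′ub′⊑v
    with returns-diverge-from-right a≢a′ | returns-diverge-from-left b≢b′
  ... | x , x′ , x≢x′ , dA@(p , _ , _ , eA , eA′) | y , y′ , y≢y′ , dD@(P , _ , _ , eD , eD′) =
    ⇔.trans (FirstDiffLess-Diverge _<A_ x≢x′ dA)
      (⇔.trans (oc (reverse p ++ φ U u ++ P) x x′ y y′ x≢x′ y≢y′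
                   (image-extension aub⊑v eA eD) (image-extension a′ub′⊑v eA′ eD′))
        (⇔.sym (FirstDiffLess-Diverge _<D_ y≢y′ (Diverge-++ʳ w dD))))

  V-no-inner-w : ∀ a p m {q t} → p ≢ [] → V a ≡ p ++ m → w ++ q ≡ m ++ w ++ t → m ≡ []
  V-no-inner-w a p m {q} {t} p≢[] Va≡ e with ++-equidivisible w q (m ++ w) t (trans e (sym (++-assoc m w t)))
  ... | inj₂ (r , w≡ , _) = proj₁ (++-infix-self m w r (sym (trans w≡ (++-assoc m w r))))
  ... | inj₁ (r , mw≡ , _) with w-in-wU a p r (begin
      p ++ w ++ r     ≡⟨ cong (p ++_) mw≡ ⟨
      p ++ m ++ w     ≡⟨ ++-assoc p m w ⟨
      (p ++ m) ++ w   ≡⟨ cong (_++ w) Va≡ ⟨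
      V a ++ w        ≡⟨ V-w≡w-U a ⟩
      w ++ U a        ∎)
    where open ≡-Reasoning
  ...   | inj₁ p≡[] = ⊥-elim (p≢[] p≡[])
  ...   | inj₂ refl = ++-identityˡ-unique m (sym (trans mw≡ (++-identityʳ w)))

  w-occurrences : ∀ v p q → p ++ w ++ q ≡ w ++ φ U v →
    ∃[ v₁ ] ∃[ v₂ ] (v ≡ v₁ ++ v₂ × p ≡ φ V v₁ × q ≡ φ U v₂)
  w-occurrences v       []      q e = [] , v , refl , refl , ++-cancelˡ w q (φ U v) e
  w-occurrences []      (c ∷ p) q e with () ← proj₁ (++-infix-self (c ∷ p) w q (trans e (++-identityʳ w)))
  w-occurrences (a ∷ v) (c ∷ p) q e
    with ++-equidivisible (c ∷ p) (w ++ q) (V a) (w ++ φ U v) (trans e (w-φ-∷ a v))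
  ... | inj₂ (m , p≡ , e₂) with v₁ , v₂ , refl , refl , refl ← w-occurrences v m q (sym e₂) =
        a ∷ v₁ , v₂ , refl , p≡ , refl
  ... | inj₁ (m , Va≡ , e₂) with refl ← V-no-inner-w a (c ∷ p) m (λ ()) Va≡ e₂ =
        [ a ] , v , refl ,
        trans (sym (++-identityʳ (c ∷ p))) (trans (sym Va≡) (sym (++-identityʳ (V a)))) ,
        ++-cancelˡ w q (φ U v) e₂

  first-w-anchor : ∀ v α x S Γ → OccursOnlyAsSuffix w (S ++ w) →
    α ++ x ∷ S ++ w ++ Γ ≡ w ++ φ U v →
    ∃[ v₁ ] ∃[ a ] ∃[ v₂ ] ∃[ c ] (v ≡ v₁ ++ a ∷ v₂ × V a ≡ c ++ x ∷ S × Γ ≡ φ U v₂)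
  first-w-anchor v α x S Γ only e
    with v₁ , v₂ , refl , αxS≡ , refl ← w-occurrences v (α ++ x ∷ S) Γ
                                          (trans (++-assoc α (x ∷ S) (w ++ Γ)) e)
    with initLast v₁
  ... | [] = ⊥-elim (++-∷≢[] α αxS≡)
  ... | v₀ ∷ʳ′ a with ++-equidivisible α (x ∷ S) (φ V v₀) (V a) (trans αxS≡ (φ-∷ʳ V v₀ a))
  ...   | inj₂ (c , _ , Va≡)     = v₀ , a , v₂ , c , ++-assoc v₀ [ a ] v₂ , Va≡ , refl
  ...   | inj₁ ([] , _ , xS≡)    = v₀ , a , v₂ , [] , ++-assoc v₀ [ a ] v₂ , sym xS≡ , refl
  -- Were x S longer than V a, then S w would contain V a w = w U a, an earlier occurrence of w.
  ...   | inj₁ (_ ∷ m , _ , xS≡) = ⊥-elim (U≢[] a (only m (U a) (begin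
      m ++ w ++ U a     ≡⟨ cong (m ++_) (V-w≡w-U a) ⟨
      m ++ V a ++ w     ≡⟨ ++-assoc m (V a) w ⟨
      (m ++ V a) ++ w   ≡⟨ cong (_++ w) (∷-injectiveʳ xS≡) ⟨
      S ++ w            ∎)))
    where open ≡-Reasoning

  w-free-extension∈L : ∀ {x y z} → ¬ Factor w z → ∀ v → F (w ++ φ U v) (x ∷ z ++ [ y ]) →
    L (x ∷ z ++ [ y ])
  w-free-extension∈L w∉z []      t⊑w = L-closed Lw (subst (Factor _) (++-identityʳ w) t⊑w)
  w-free-extension∈L w∉z (a ∷ v) t⊑wφv
    with Factor-straddle (V a) w (φ U v) (subst (Factor _) (w-φ-∷ a v) t⊑wφv)
  ... | inj₁ t⊑Vaw         = L-closed (wU∈L a) (subst (Factor _) (V-w≡w-U a) t⊑Vaw)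
  ... | inj₂ (inj₁ t⊑wφv′) = w-free-extension∈L w∉z v t⊑wφv′
  ... | inj₂ (inj₂ w⊑z)    = ⊥-elim (w∉z w⊑z)

  record Preimage (v : List (Fin s)) (x : A) (S R : List A) (y : A) : Set where
    constructor preimage
    field
      {a b}   : Fin s
      u       : List (Fin s)
      c P d   : List A
      aub⊑v   : F v (a ∷ u ++ [ b ])
      V-split : V a ≡ c ++ x ∷ S
      R-split : R ≡ φ U u ++ P
      U-split : U b ≡ P ++ y ∷ d

  preimage-of : ∀ {v x S R y} → OccursOnlyAsSuffix w (S ++ w) →
    F (w ++ φ U v) (x ∷ (S ++ w ++ R) ++ [ y ]) → Preimage v x S R y
  preimage-of {v} {x} {S} {R} {y} only (α , β , e)
    with first-w-anchor v α x S (R ++ y ∷ β) only (trans (reassoc α [ x ] S w R [ y ] β) e)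
    where
    reassoc : ∀ α X S w R Y β → α ++ X ++ S ++ w ++ R ++ Y ++ β ≡ α ++ (X ++ (S ++ w ++ R) ++ Y) ++ β
    reassoc _ _ _ _ _ _ _ = solve (++-monoid A)
  ... | v₁ , a , v₂ , c , refl , Va≡ , Γ≡ with φ-split U v₂ R y β Γ≡
  ...   | u , b , v₃ , P , d , refl , R≡ , Ub≡ =
          preimage u c P d (v₁ , v₃ , cong (λ t → v₁ ++ a ∷ t) (++-assoc u [ b ] v₃)) Va≡ R≡ Ub≡

  preimage-orders : ∀ {v x x′ S R y y′} → x ≢ x′ → y ≢ y′ →
    OrderCondition′ (DerivedA _<A_ w U) (DerivedD _<D_ w U) (F v) →
    Preimage v x S R y → Preimage v x′ S R y′ → (x <A x′) ⇔ (y <D y′)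
  preimage-orders {x = x} {x′} {S} x≢x′ y≢y′ oc
    (preimage {a} {b} u c P d aub⊑v Va≡ R≡ Ub≡)
    (preimage {a′} {b′} u′ c′ P′ d′ a′ub′⊑v Va′≡ R≡′ Ub′≡)
    with refl , refl ← φ-parse-unique u u′ P P′ (trans (sym R≡) R≡′) Ub≡ Ub′≡ =
    ⇔.trans (⇔.sym (FirstDiffLess-Diverge _<A_ x≢x′ dA))
      (⇔.trans (oc u a a′ b b′ (Diverge⇒≢ (λ i → reverse (w ++ U i)) x≢x′ dA)
                               (Diverge⇒≢ (λ i → U i ++ w) y≢y′ dD) aub⊑v a′ub′⊑v)
        (FirstDiffLess-Diverge _<D_ y≢y′ dD))
    where
    reverse-wU : ∀ {a c x} → V a ≡ c ++ x ∷ S → reverse (w ++ U a) ≡ reverse (S ++ w) ++ x ∷ reverse c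
    reverse-wU {a} {c} {x} Va≡ = begin
      reverse (w ++ U a)          ≡⟨ cong reverse (V-w≡w-U a) ⟨
      reverse (V a ++ w)          ≡⟨ cong (λ l → reverse (l ++ w)) Va≡ ⟩
      reverse ((c ++ x ∷ S) ++ w) ≡⟨ cong reverse (++-assoc c (x ∷ S) w) ⟩
      reverse (c ++ x ∷ S ++ w)   ≡⟨ reverse-++-∷ c x (S ++ w) ⟩
      reverse (S ++ w) ++ x ∷ reverse c ∎
      where open ≡-Reasoning
    dA : Diverge (reverse (w ++ U a)) (reverse (w ++ U a′)) x x′
    dA = reverse (S ++ w) , reverse c , reverse c′ , reverse-wU Va≡ , reverse-wU Va′≡
    dD : Diverge (U b ++ w) (U b′ ++ w) _ _
    dD = Diverge-++ʳ w (P , d , d′ , Ub≡ , Ub′≡)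

  backward : ∀ v → OrderCondition′ (DerivedA _<A_ w U) (DerivedD _<D_ w U) (F v) →
    OrderCondition′ _<A_ _<D_ (F (w ++ φ U v))
  backward v oc z x x′ y y′ x≢x′ y≢y′ xzy⊑ x′zy′⊑ with firstOccurrence _≟_ w z
  ... | inj₂ w∉z =
    L-order z x x′ y y′ x≢x′ y≢y′ (w-free-extension∈L w∉z v xzy⊑) (w-free-extension∈L w∉z v x′zy′⊑)
  ... | inj₁ (S , R , refl , only) =
    preimage-orders x≢x′ y≢y′ oc (preimage-of only xzy⊑) (preimage-of only x′zy′⊑)

  orderCondition′-transfer : ∀ v → OrderCondition′ _<A_ _<D_ (F (w ++ φ U v)) ⇔
    OrderCondition′ (DerivedA _<A_ w U) (DerivedD _<D_ w U) (F v)
  orderCondition′-transfer v = mk⇔ (forward v) (backward v)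

module _ {A : Set} where

  suffixReturn-reverse : ∀ (L : WordSet A) w u → PrefixReturn L w u →
    SuffixReturn (L ∘ reverse) (reverse w) (reverse u)
  suffixReturn-reverse L w u (Lu , Luw , u≢[] , (q , wq≡uw) , w-in-uw) =
    subst L (sym (reverse-involutive u)) Lu ,
    subst L (sym (reverse-reverse-++ w u)) Luw ,
    (λ u′≡[] → u≢[] (reverse-injective u′≡[])) ,
    (reverse q , trans (sym (reverse-++ w q)) (trans (cong reverse wq≡uw) (reverse-++ u w))) ,
    w′-in-w′u′
    where
    w′-in-w′u′ : ∀ p q → p ++ reverse w ++ q ≡ reverse w ++ reverse u → p ≡ [] ⊎ q ≡ []
    w′-in-w′u′ p q e with w-in-uw (reverse q) (reverse p) (begin
        reverse q ++ w ++ reverse p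
          ≡⟨ cong (λ l → reverse q ++ l ++ reverse p) (reverse-involutive w) ⟨
        reverse q ++ reverse (reverse w) ++ reverse p   ≡⟨ ++-assoc (reverse q) _ (reverse p) ⟨
        (reverse q ++ reverse (reverse w)) ++ reverse p ≡⟨ cong (_++ reverse p) (reverse-++ (reverse w) q) ⟨
        reverse (reverse w ++ q) ++ reverse p           ≡⟨ reverse-++ p (reverse w ++ q) ⟨
        reverse (p ++ reverse w ++ q)                   ≡⟨ cong reverse e ⟩
        reverse (reverse w ++ reverse u)                ≡⟨ reverse-reverse-++ w u ⟩
        u ++ w                                          ∎)
      where open ≡-Reasoning
    ... | inj₁ q′≡[] = inj₂ (reverse-injective q′≡[])
    ... | inj₂ p′≡[] = inj₁ (reverse-injective p′≡[])

  module _ (_≟_ : DecidableEquality A) {_<A_ _<D_ : Rel A 0ℓ} {L : WordSet A}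
    (L-closed : FactorClosed L) (L-order : OrderCondition′ _<A_ _<D_ L) {w : List A} (Lw : L w)
    {s : ℕ} {U : Fin s → List A} (U-injective : Injective _≡_ _≡_ U) where

    open import Relation.Binary.Reasoning.Setoid (⇔.⇔-setoid 0ℓ)

    orderCondition-suffixReturns : (∀ a → SuffixReturn L w (U a)) → ∀ v →
      OrderCondition _<A_ _<D_ (F (w ++ φ U v)) ⇔ OrderCondition (DerivedA _<A_ w U) (DerivedD _<D_ w U) (F v)
    orderCondition-suffixReturns U-return v = begin
      OrderCondition _<A_ _<D_ (F (w ++ φ U v))
        ≈⟨ OrderCondition⇔OrderCondition′ (F-factorClosed _) ⟩
      OrderCondition′ _<A_ _<D_ (F (w ++ φ U v))
        ≈⟨ SuffixReturnCode.orderCondition′-transfer _≟_ _<A_ _<D_ L L-closed L-order w Lw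
             U U-injective U-return v ⟩
      OrderCondition′ (DerivedA _<A_ w U) (DerivedD _<D_ w U) (F v)
        ≈⟨ OrderCondition⇔OrderCondition′ (F-factorClosed v) ⟨
      OrderCondition (DerivedA _<A_ w U) (DerivedD _<D_ w U) (F v)
        ∎

    orderCondition-prefixReturns : (∀ a → PrefixReturn L w (U a)) → ∀ v →
      OrderCondition _<A_ _<D_ (F (φ U v ++ w)) ⇔ OrderCondition (DerivedA _<A_ w U) (DerivedD _<D_ w U) (F v)
    orderCondition-prefixReturns U-return v = begin
      OrderCondition _<A_ _<D_ (F (φ U v ++ w))
        ≈⟨ OrderCondition⇔OrderCondition′ (F-factorClosed _) ⟩
      OrderCondition′ _<A_ _<D_ (F (φ U v ++ w))
        ≈⟨ OrderCondition′-F-reverse (φ U v ++ w) ⟩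
      OrderCondition′ _<D_ _<A_ (F (reverse (φ U v ++ w)))
        ≡⟨ cong (OrderCondition′ _<D_ _<A_ ∘ F) reverse-φ-w ⟩
      OrderCondition′ _<D_ _<A_ (F (reverse w ++ φ U′ (reverse v)))
        ≈⟨ SuffixReturnCode.orderCondition′-transfer _≟_ _<D_ _<A_ (L ∘ reverse) L′-closed
             (OrderCondition′-reverse {S = L} L-order) (reverse w) (subst L (sym (reverse-involutive w)) Lw)
             U′ (U-injective ∘ reverse-injective) (λ a → suffixReturn-reverse L w (U a) (U-return a))
             (reverse v) ⟩
      OrderCondition′ (DerivedA _<D_ (reverse w) U′) (DerivedD _<A_ (reverse w) U′) (F (reverse v))
        ≈⟨ OrderCondition′-cong {S = F (reverse v)}
             (λ a b → FirstDiffLess-cong _<D_ (reverse-reverse-++ w (U a)) (reverse-reverse-++ w (U b)))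
             (λ a b → FirstDiffLess-cong _<A_ (sym (reverse-++ w (U a))) (sym (reverse-++ w (U b)))) ⟩
      OrderCondition′ (DerivedD _<D_ w U) (DerivedA _<A_ w U) (F (reverse v))
        ≈⟨ OrderCondition′-F-reverse v ⟨
      OrderCondition′ (DerivedA _<A_ w U) (DerivedD _<D_ w U) (F v)
        ≈⟨ OrderCondition⇔OrderCondition′ (F-factorClosed v) ⟨
      OrderCondition (DerivedA _<A_ w U) (DerivedD _<D_ w U) (F v)
        ∎
      where
      U′ : Fin s → List A
      U′ = reverse ∘ U
      reverse-φ-w : reverse (φ U v ++ w) ≡ reverse w ++ φ U′ (reverse v)
      reverse-φ-w = trans (reverse-++ (φ U v) w) (cong (reverse w ++_) (φ-reverse U v))
      L′-closed : FactorClosed (L ∘ reverse)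
      L′-closed Lt′ u⊑t = L-closed Lt′ (Factor-reverse u⊑t)

proposition1 : (r : ℕ) (_<A_ _<D_ : Rel (Fin r) 0ℓ) →
    IsStrictTotalOrder _≡_ _<A_ → IsStrictTotalOrder _≡_ _<D_ →
    (L : WordSet (Fin r)) → IsLanguage L → OrderCondition _<A_ _<D_ L →
    (w : List (Fin r)) → L w →
    (s : ℕ) → 1 ≤ s → s ≤ r →
    (U : Fin s → List (Fin r)) → Injective _≡_ _≡_ U →
    ((∀ i → SuffixReturn L w (U i)) →
      ∀ (v : List (Fin s)) →
        OrderCondition _<A_ _<D_ (F (w ++ φ U v))
          ⇔ OrderCondition (DerivedA _<A_ w U) (DerivedD _<D_ w U) (F v))
    ×
    ((∀ i → PrefixReturn L w (U i)) →
      ∀ (v : List (Fin s)) →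
        OrderCondition _<A_ _<D_ (F (φ U v ++ w))
          ⇔ OrderCondition (DerivedA _<A_ w U) (DerivedD _<D_ w U) (F v))
proposition1 r _<A_ _<D_ _ _ L L-language L-order w Lw s _ _ U U-injective =
  orderCondition-suffixReturns Fin._≟_ L-closed L-order′ Lw U-injective ,
  orderCondition-prefixReturns Fin._≟_ L-closed L-order′ Lw U-injective
  where
  L-closed : FactorClosed L
  L-closed = IsLanguage.factorial L-language
  L-order′ : OrderCondition′ _<A_ _<D_ L
  L-order′ = Equivalence.to (OrderCondition⇔OrderCondition′ L-closed) L-order
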